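{- Let $G$ be a connected graph with at least $2$ vertices and $H$ a connected graph. Then \[F(G+_T H)=8|V(H)|F(G)+|V(G)|F(H)+24|E(H)|M_1(G)+12|E(G)|M_1(H)+|V(H)|\xi_4(G)+3|V(H)|\,\mathrm{ReZM}(G).\]
   Context: All graphs are finite, simple and undirected; $d_G(v)$ denotes degree. $F(G)=\sum_{v\in V(G)}d_G(v)^3$, $M_1(G)=\sum_{v\in V(G)}d_G(v)^2$, $\xi_4(G)=\sum_{v\in V(G)}d_G(v)^4$, and $\mathrm{ReZM}(G)=\sum_{uv\in E(G)}d_G(u)d_G(v)[d_G(u)+d_G(v)]$. The total graph $T(G)$ has vertex set $V(G)\cup E(G)$, two of these elements being adjacent if and only if they are adjacent or incident in $G$. The $T$-sum $G+_T H$ is the graph with vertex set $(V(G)\cup E(G))\times V(H)$ in which $(u,v)$ and $(u',v')$ are adjacent if and only if [$u=u'\in V(G)$ and $vv'\in E(H)$] or [$v=v'$ and $uu'\in E(T(G))$]. -}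

module Defs where

open import Data.Nat using (ℕ; zero; suc; _+_; _*_; _^_; _<ᵇ_; _≤_)
open import Data.Bool using (Bool; true; false; if_then_else_; _∧_; _∨_; not)
open import Data.Fin using (Fin; toℕ; splitAt; remQuot)
open import Data.Fin.Properties using (_≟_)
open import Data.Sum using (_⊎_; inj₁; inj₂)
open import Data.Product using (_×_; _,_; proj₁; proj₂)
open import Data.List using (List; []; [_]; length; map; allFin; concatMap; lookup)
open import Data.Nat.ListAction using (sum)
open import Relation.Nullary.Decidable using (⌊_⌋)
open import Relation.Binary.PropositionalEquality using (_≡_)

record Graph : Set where
  constructor mkGraph
  field
    n   : ℕ
    adj : Fin n → Fin n → Bool
open Graph public

record IsSimple (G : Graph) : Set where
  field
    adj-sym     : ∀ i j → adj G i j ≡ adj G j i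
    adj-irrefl  : ∀ i → adj G i i ≡ false

data Reachable (G : Graph) : Fin (n G) → Fin (n G) → Set where
  here : ∀ {i} → Reachable G i i
  step : ∀ {i j k} → adj G i j ≡ true → Reachable G j k → Reachable G i k

Connected : Graph → Set
Connected G = ∀ i j → Reachable G i j

order : Graph → ℕ
order G = n G

deg : (G : Graph) → Fin (n G) → ℕ
deg G v = sum (map (λ w → if adj G v w then 1 else 0) (allFin (n G)))

edgeList : (G : Graph) → List (Fin (n G) × Fin (n G))
edgeList G = concatMap (λ i → concatMap (λ j →
    if adj G i j ∧ (toℕ i <ᵇ toℕ j) then [ (i , j) ] else [])
  (allFin (n G))) (allFin (n G))

size : Graph → ℕ
size G = length (edgeList G)

degPowSum : ℕ → Graph → ℕ
degPowSum k G = sum (map (λ v → deg G v ^ k) (allFin (n G)))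

M₁ : Graph → ℕ
M₁ = degPowSum 2

F : Graph → ℕ
F = degPowSum 3

ξ₄ : Graph → ℕ
ξ₄ = degPowSum 4

ReZM : Graph → ℕ
ReZM G = sum (map (λ e → let du = deg G (proj₁ e) ; dv = deg G (proj₂ e)
                          in du * dv * (du + dv)) (edgeList G))

edgeAt : (G : Graph) → Fin (size G) → Fin (n G) × Fin (n G)
edgeAt G = lookup (edgeList G)

eqB : ∀ {m} → Fin m → Fin m → Bool
eqB a b = ⌊ a ≟ b ⌋

incident : (G : Graph) → Fin (n G) → Fin (size G) → Bool
incident G v e = eqB v (proj₁ (edgeAt G e)) ∨ eqB v (proj₂ (edgeAt G e))

edgesAdj : (G : Graph) → Fin (size G) → Fin (size G) → Bool
edgesAdj G e f = not (eqB e f) ∧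
  (incident G (proj₁ (edgeAt G e)) f ∨ incident G (proj₂ (edgeAt G e)) f)

-- total graph T(G): vertex set V(G) ⊎ E(G), encoded as Fin (|V| + |E|)
-- (first |V| elements are vertices, remaining |E| elements are edges)
totalAdj : (G : Graph) → Fin (n G + size G) → Fin (n G + size G) → Bool
totalAdj G a b with splitAt (n G) a | splitAt (n G) b
... | inj₁ u | inj₁ v = adj G u v
... | inj₁ u | inj₂ e = incident G u e
... | inj₂ e | inj₁ u = incident G u e
... | inj₂ e | inj₂ f = edgesAdj G e f

TotalGraph : Graph → Graph
TotalGraph G = mkGraph (n G + size G) (totalAdj G)

isVertexOfG : (G : Graph) → Fin (n G + size G) → Bool
isVertexOfG G a with splitAt (n G) a
... | inj₁ _ = true
... | inj₂ _ = false

-- T-sum G +_T H: vertex set (V(G) ∪ E(G)) × V(H), encoded via remQuot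
tSumAdj : (G H : Graph) → Fin ((n G + size G) * n H) → Fin ((n G + size G) * n H) → Bool
tSumAdj G H p q with remQuot (n H) p | remQuot (n H) q
... | (a , v) | (a' , v') =
  (eqB a a' ∧ isVertexOfG G a ∧ adj H v v') ∨ (eqB v v' ∧ totalAdj G a a')

_+T_ : Graph → Graph → Graph
G +T H = mkGraph ((n G + size G) * n H) (tSumAdj G H)

-- A vertex (u , v) of G +_T H with u ∈ V(G) has degree d_H(v) + 2 d_G(u): in T(G) the vertex u
-- sees its d_G(u) neighbours and its d_G(u) incident edges.  A vertex (e , v) with e = ab has
-- degree d_G(a) + d_G(b): in T(G) the edge e sees its two endpoints and the d_G(a) + d_G(b) - 2
-- edges sharing an endpoint with it, and it has no neighbours in its own copy of H.  Summing cubes,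
-- (d_H(v) + 2 d_G(u))³ expands into power sums of the degrees of G and H (with ∑ d = 2|E|), and
-- (d(a) + d(b))³ = d(a)³ + d(b)³ + 3 d(a) d(b) (d(a) + d(b)), where the handshake identity
-- ∑_{ab ∈ E} (g(a) + g(b)) = ∑_u d(u) g(u) turns the first part into ξ₄(G).

module Submission where

open import Defs
open import Data.Bool using (Bool; true; false; if_then_else_; _∧_; _∨_; not)
open import Data.Bool.Properties using (T-≡)
open import Data.Empty using (⊥-elim)
open import Data.Fin using (Fin; zero; suc; toℕ; splitAt; remQuot; combine; _↑ˡ_; _↑ʳ_)
open import Data.Fin.Properties using (_≟_; splitAt-↑ˡ; splitAt-↑ʳ; remQuot-combine; toℕ-injective)
open import Data.List using (List; []; _∷_; [_]; length; map; allFin; concatMap; lookup; tabulate; _++_)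
open import Data.List.Properties using (map-tabulate; map-++)
open import Data.List.Membership.Propositional.Properties using (∈-lookup)
open import Data.List.Relation.Unary.All as All using (All; []; _∷_)
open import Data.List.Relation.Unary.All.Properties using (concat⁺; map⁺; tabulate⁺)
import Data.Nat.ListAction as List
open import Data.Nat.ListAction.Properties using (sum-++)
open import Data.Nat using (ℕ; zero; suc; _+_; _*_; _^_; _<ᵇ_; _≤_; _<_)
open import Data.Nat.Properties
  using (+-*-semiring; +-assoc; +-comm; *-comm; *-distribʳ-+; +-identityʳ; *-identityʳ; *-zeroʳ; <-irrefl; <-asym; <-cmp; <ᵇ⇒<; <⇒<ᵇ)
open import Algebra.Properties.Semiring.Sum +-*-semiring
  using (sum-syntax; sum-cong-≗; ∑-distrib-+; ∑-comm; *-distribˡ-sum; *-distribʳ-sum)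
open import Data.Nat.Solver using (module +-*-Solver)
open import Data.Nat.Tactic.RingSolver using (solve-∀)
open import Data.Product using (_×_; _,_; proj₁; proj₂)
open import Data.Sum using (inj₁; inj₂)
open import Function using (id; _∘_; Equivalence)
open import Relation.Binary.Definitions using (tri<; tri≈; tri>)
open import Relation.Binary.PropositionalEquality
  using (_≡_; _≢_; refl; sym; trans; cong; cong₂; module ≡-Reasoning)
open import Relation.Nullary using (¬_)
open import Relation.Nullary.Decidable using (yes; no)

open +-*-Solver using (solve; _:+_; _:*_; _:^_; _:=_; con)

-- Indicators and finite sums

𝟙 : Bool → ℕ
𝟙 b = if b then 1 else 0

𝟙-∧ : ∀ b c → 𝟙 (b ∧ c) ≡ 𝟙 b * 𝟙 c
𝟙-∧ true  true  = refl
𝟙-∧ true  false = refl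
𝟙-∧ false c     = refl

𝟙-∨ : ∀ b c → 𝟙 (b ∨ c) + 𝟙 (b ∧ c) ≡ 𝟙 b + 𝟙 c
𝟙-∨ true  true  = refl
𝟙-∨ true  false = refl
𝟙-∨ false true  = refl
𝟙-∨ false false = refl

𝟙-∨-disjoint : ∀ b c → b ∧ c ≡ false → 𝟙 (b ∨ c) ≡ 𝟙 b + 𝟙 c
𝟙-∨-disjoint b c b∧c≡false = begin
  𝟙 (b ∨ c)               ≡⟨ sym (+-identityʳ _) ⟩
  𝟙 (b ∨ c) + 0           ≡⟨ cong (λ x → 𝟙 (b ∨ c) + 𝟙 x) (sym b∧c≡false) ⟩
  𝟙 (b ∨ c) + 𝟙 (b ∧ c)   ≡⟨ 𝟙-∨ b c ⟩
  𝟙 b + 𝟙 c               ∎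
  where open ≡-Reasoning

𝟙-not-∧ : ∀ b c → 𝟙 (not b ∧ c) + 𝟙 (b ∧ c) ≡ 𝟙 c
𝟙-not-∧ true  c     = refl
𝟙-not-∧ false true  = refl
𝟙-not-∧ false false = refl

𝟙-∨-∧ : ∀ b x c y → (b ≡ true → y ≡ false) → 𝟙 ((b ∧ x) ∨ (c ∧ y)) ≡ 𝟙 b * 𝟙 x + 𝟙 c * 𝟙 y
𝟙-∨-∧ false x c y _ = 𝟙-∧ c y
𝟙-∨-∧ true x c y b⇒¬y with b⇒¬y refl
𝟙-∨-∧ true true  true  .false _ | refl = refl
𝟙-∨-∧ true true  false .false _ | refl = refl
𝟙-∨-∧ true false true  .false _ | refl = refl
𝟙-∨-∧ true false false .false _ | refl = refl

eqB-refl : ∀ {k} (a : Fin k) → eqB a a ≡ true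
eqB-refl a with a ≟ a
... | yes _   = refl
... | no a≢a = ⊥-elim (a≢a refl)

eqB-sym : ∀ {k} (a b : Fin k) → eqB a b ≡ eqB b a
eqB-sym a b with a ≟ b | b ≟ a
... | yes _   | yes _   = refl
... | no _    | no _    = refl
... | yes a≡b | no b≢a = ⊥-elim (b≢a (sym a≡b))
... | no a≢b  | yes b≡a = ⊥-elim (a≢b (sym b≡a))

eqB≡true⇒≡ : ∀ {k} {a b : Fin k} → eqB a b ≡ true → a ≡ b
eqB≡true⇒≡ {a = a} {b} _ with a ≟ b
eqB≡true⇒≡ _  | yes a≡b = a≡b
eqB≡true⇒≡ () | no _

eqB-∧-distinct : ∀ {k} (u a b : Fin k) → a ≢ b → eqB u a ∧ eqB u b ≡ false
eqB-∧-distinct u a b a≢b with u ≟ a | u ≟ b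
... | yes refl | yes refl = ⊥-elim (a≢b refl)
... | yes _    | no _     = refl
... | no _     | _        = refl

𝟙-eqB-∨ : ∀ {k} {a b : Fin k} → a ≢ b → ∀ u → 𝟙 (eqB u a ∨ eqB u b) ≡ 𝟙 (eqB u a) + 𝟙 (eqB u b)
𝟙-eqB-∨ {a = a} {b} a≢b u = 𝟙-∨-disjoint (eqB u a) (eqB u b) (eqB-∧-distinct u a b a≢b)

<⇒<ᵇ≡true : ∀ {m n} → m < n → (m <ᵇ n) ≡ true
<⇒<ᵇ≡true m<n = Equivalence.to T-≡ (<⇒<ᵇ m<n)

≮⇒<ᵇ≡false : ∀ {m n} → ¬ m < n → (m <ᵇ n) ≡ false
≮⇒<ᵇ≡false {m} {n} m≮n with m <ᵇ n in m<ᵇn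
... | false = refl
... | true  = ⊥-elim (m≮n (<ᵇ⇒< m n (Equivalence.from T-≡ m<ᵇn)))

∑-const : ∀ n c → ∑[ i < n ] c ≡ n * c
∑-const zero    c = refl
∑-const (suc n) c = cong (c +_) (∑-const n c)

∑-splitAt : ∀ m n (f : Fin (m + n) → ℕ) →
  ∑[ k < m + n ] f k ≡ ∑[ i < m ] f (i ↑ˡ n) + ∑[ j < n ] f (m ↑ʳ j)
∑-splitAt zero    n f = refl
∑-splitAt (suc m) n f =
  trans (cong (f zero +_) (∑-splitAt m n (f ∘ suc))) (sym (+-assoc (f zero) _ _))

∑-combine : ∀ m n (f : Fin (m * n) → ℕ) →
  ∑[ k < m * n ] f k ≡ ∑[ i < m ] ∑[ j < n ] f (combine i j)
∑-combine zero    n f = refl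
∑-combine (suc m) n f =
  trans (∑-splitAt n (m * n) f) (cong (∑[ j < n ] f (j ↑ˡ m * n) +_) (∑-combine m n (f ∘ (n ↑ʳ_))))

∑-δ : ∀ n (u : Fin n) (f : Fin n → ℕ) → ∑[ i < n ] (𝟙 (eqB u i) * f i) ≡ f u
∑-δ (suc n) zero f =
  trans (cong₂ _+_ (+-identityʳ (f zero)) (trans (∑-const n 0) (*-zeroʳ n))) (+-identityʳ (f zero))
∑-δ (suc n) (suc u) f = trans (sum-cong-≗ δ-suc) (∑-δ n u (f ∘ suc))
  where
  δ-suc : ∀ i → 𝟙 (eqB (suc u) (suc i)) * f (suc i) ≡ 𝟙 (eqB u i) * f (suc i)
  δ-suc i with u ≟ i
  ... | yes _ = refl
  ... | no _  = refl

∑-δ′ : ∀ n (u : Fin n) (f : Fin n → ℕ) → ∑[ i < n ] (𝟙 (eqB i u) * f i) ≡ f u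
∑-δ′ n u f = trans (sum-cong-≗ (λ i → cong (λ b → 𝟙 b * f i) (eqB-sym i u))) (∑-δ n u f)

∑-cubic : ∀ n a b c d (x : Fin n → ℕ) →
  ∑[ i < n ] (a * x i ^ 3 + b * x i ^ 2 + c * x i + d)
    ≡ a * ∑[ i < n ] (x i ^ 3) + b * ∑[ i < n ] (x i ^ 2) + c * ∑[ i < n ] x i + n * d
∑-cubic n a b c d x = begin
  ∑[ i < n ] (a * x i ^ 3 + b * x i ^ 2 + c * x i + d)
    ≡⟨ ∑-distrib-+ (λ i → a * x i ^ 3 + b * x i ^ 2 + c * x i) (λ _ → d) ⟩
  ∑[ i < n ] (a * x i ^ 3 + b * x i ^ 2 + c * x i) + ∑[ i < n ] d
    ≡⟨ cong₂ _+_ (∑-distrib-+ (λ i → a * x i ^ 3 + b * x i ^ 2) (λ i → c * x i)) (∑-const n d) ⟩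
  ∑[ i < n ] (a * x i ^ 3 + b * x i ^ 2) + ∑[ i < n ] (c * x i) + n * d
    ≡⟨ cong (λ s → s + ∑[ i < n ] (c * x i) + n * d) (∑-distrib-+ (λ i → a * x i ^ 3) (λ i → b * x i ^ 2)) ⟩
  ∑[ i < n ] (a * x i ^ 3) + ∑[ i < n ] (b * x i ^ 2) + ∑[ i < n ] (c * x i) + n * d
    ≡⟨ sym (cong₂ (λ s t → s + t + _ + n * d) (*-distribˡ-sum a (λ i → x i ^ 3)) (*-distribˡ-sum b (λ i → x i ^ 2))) ⟩
  a * ∑[ i < n ] (x i ^ 3) + b * ∑[ i < n ] (x i ^ 2) + ∑[ i < n ] (c * x i) + n * d
    ≡⟨ sym (cong (λ s → a * _ + b * _ + s + n * d) (*-distribˡ-sum c x)) ⟩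
  a * ∑[ i < n ] (x i ^ 3) + b * ∑[ i < n ] (x i ^ 2) + c * ∑[ i < n ] x i + n * d ∎
  where open ≡-Reasoning

sum-tabulate : ∀ n (f : Fin n → ℕ) → List.sum (tabulate f) ≡ ∑[ i < n ] f i
sum-tabulate zero    f = refl
sum-tabulate (suc n) f = cong (f zero +_) (sum-tabulate n (f ∘ suc))

sum-map-allFin : ∀ n (f : Fin n → ℕ) → List.sum (map f (allFin n)) ≡ ∑[ i < n ] f i
sum-map-allFin n f = trans (cong List.sum (map-tabulate id f)) (sum-tabulate n f)

sum-map-lookup : ∀ {A : Set} (xs : List A) (f : A → ℕ) →
  List.sum (map f xs) ≡ ∑[ k < length xs ] f (lookup xs k)
sum-map-lookup []       f = refl
sum-map-lookup (x ∷ xs) f = cong (f x +_) (sum-map-lookup xs f)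

sum-map-concatMap : ∀ {A B : Set} (g : A → List B) (f : B → ℕ) (xs : List A) →
  List.sum (map f (concatMap g xs)) ≡ List.sum (map (λ x → List.sum (map f (g x))) xs)
sum-map-concatMap g f []       = refl
sum-map-concatMap g f (x ∷ xs) = begin
  List.sum (map f (g x ++ concatMap g xs))
    ≡⟨ cong List.sum (map-++ f (g x) (concatMap g xs)) ⟩
  List.sum (map f (g x) ++ map f (concatMap g xs))
    ≡⟨ sum-++ (map f (g x)) _ ⟩
  List.sum (map f (g x)) + List.sum (map f (concatMap g xs))
    ≡⟨ cong (List.sum (map f (g x)) +_) (sum-map-concatMap g f xs) ⟩
  List.sum (map f (g x)) + List.sum (map (λ y → List.sum (map f (g y))) xs) ∎
  where open ≡-Reasoning

sum-map-singleton-if : ∀ {B : Set} (f : B → ℕ) b x → List.sum (map f (if b then [ x ] else [])) ≡ 𝟙 b * f x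
sum-map-singleton-if f true  x = refl
sum-map-singleton-if f false x = refl

degPowSum-∑ : ∀ k G → degPowSum k G ≡ ∑[ v < n G ] (deg G v ^ k)
degPowSum-∑ k G = sum-map-allFin (n G) _

-- The edge list

module _ (G : Graph) where

  listed : Fin (n G) → Fin (n G) → Bool
  listed i j = adj G i j ∧ (toℕ i <ᵇ toℕ j)

  listed⇒< : ∀ {i j} → listed i j ≡ true → toℕ i < toℕ j
  listed⇒< {i} {j} listed-ij with adj G i j
  ... | true = <ᵇ⇒< (toℕ i) (toℕ j) (Equivalence.from T-≡ listed-ij)

  listed⇒≢ : ∀ {i j} → listed i j ≡ true → i ≢ j
  listed⇒≢ listed-ij refl = <-irrefl refl (listed⇒< listed-ij)

  listed-asym : ∀ {i j} → listed i j ≡ true → listed j i ≡ false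
  listed-asym {i} {j} listed-ij with listed j i in listed-ji
  ... | false = refl
  ... | true  = ⊥-elim (<-asym (listed⇒< listed-ij) (listed⇒< listed-ji))

  edgeList-listed : All (λ e → listed (proj₁ e) (proj₂ e) ≡ true) (edgeList G)
  edgeList-listed = concat⁺ (map⁺ (tabulate⁺ λ i → concat⁺ (map⁺ (tabulate⁺ λ j → singleton-listed i j))))
    where
    singleton-listed : ∀ i j → All (λ e → listed (proj₁ e) (proj₂ e) ≡ true) (if listed i j then [ (i , j) ] else [])
    singleton-listed i j with listed i j in listed-ij
    ... | true  = listed-ij ∷ []
    ... | false = []

  edgeAt-listed : ∀ e → listed (proj₁ (edgeAt G e)) (proj₂ (edgeAt G e)) ≡ true
  edgeAt-listed e = All.lookup edgeList-listed (∈-lookup e)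

  ∑-edgeAt : ∀ (f : Fin (n G) × Fin (n G) → ℕ) →
    ∑[ e < size G ] f (edgeAt G e) ≡ ∑[ i < n G ] ∑[ j < n G ] (𝟙 (listed i j) * f (i , j))
  ∑-edgeAt f = begin
    ∑[ e < size G ] f (edgeAt G e)
      ≡⟨ sym (sum-map-lookup (edgeList G) f) ⟩
    List.sum (map f (edgeList G))
      ≡⟨ sum-map-concatMap row f (allFin (n G)) ⟩
    List.sum (map (λ i → List.sum (map f (row i))) (allFin (n G)))
      ≡⟨ sum-map-allFin (n G) _ ⟩
    ∑[ i < n G ] List.sum (map f (row i))
      ≡⟨ sum-cong-≗ row-sum ⟩
    ∑[ i < n G ] ∑[ j < n G ] (𝟙 (listed i j) * f (i , j)) ∎
    where
    open ≡-Reasoning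
    row : Fin (n G) → List (Fin (n G) × Fin (n G))
    row i = concatMap (λ j → if listed i j then [ (i , j) ] else []) (allFin (n G))
    row-sum : ∀ i → List.sum (map f (row i)) ≡ ∑[ j < n G ] (𝟙 (listed i j) * f (i , j))
    row-sum i = begin
      List.sum (map f (row i))
        ≡⟨ sum-map-concatMap _ f (allFin (n G)) ⟩
      List.sum (map (λ j → List.sum (map f (if listed i j then [ (i , j) ] else []))) (allFin (n G)))
        ≡⟨ sum-map-allFin (n G) _ ⟩
      ∑[ j < n G ] List.sum (map f (if listed i j then [ (i , j) ] else []))
        ≡⟨ sum-cong-≗ (λ j → sum-map-singleton-if f (listed i j) (i , j)) ⟩
      ∑[ j < n G ] (𝟙 (listed i j) * f (i , j)) ∎

  edgeAt-≢ : ∀ e → proj₁ (edgeAt G e) ≢ proj₂ (edgeAt G e)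
  edgeAt-≢ e = listed⇒≢ (edgeAt-listed e)

  𝟙-listed-incident : ∀ u i j →
    𝟙 (listed i j) * 𝟙 (eqB u i ∨ eqB u j) ≡ 𝟙 (eqB u i) * 𝟙 (listed i j) + 𝟙 (eqB u j) * 𝟙 (listed i j)
  𝟙-listed-incident u i j with listed i j in listed-ij
  ... | false = sym (cong₂ _+_ (*-zeroʳ (𝟙 (eqB u i))) (*-zeroʳ (𝟙 (eqB u j))))
  ... | true  = begin
    𝟙 (eqB u i ∨ eqB u j) + 0                 ≡⟨ +-identityʳ (𝟙 (eqB u i ∨ eqB u j)) ⟩
    𝟙 (eqB u i ∨ eqB u j)                     ≡⟨ 𝟙-eqB-∨ (listed⇒≢ listed-ij) u ⟩
    𝟙 (eqB u i) + 𝟙 (eqB u j)                 ≡⟨ sym (cong₂ _+_ (*-identityʳ (𝟙 (eqB u i))) (*-identityʳ (𝟙 (eqB u j)))) ⟩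
    𝟙 (eqB u i) * 1 + 𝟙 (eqB u j) * 1        ∎
    where open ≡-Reasoning

  𝟙-listed-through : ∀ {i j} → listed i j ≡ true → ∀ i′ j′ →
    𝟙 (listed i′ j′) * 𝟙 ((eqB i i′ ∨ eqB i j′) ∧ (eqB j i′ ∨ eqB j j′))
      ≡ 𝟙 (eqB i i′) * (𝟙 (eqB j j′) * 𝟙 (listed i′ j′))
  𝟙-listed-through {i} {j} listed-ij i′ j′ with i ≟ i′
  ... | yes refl with j ≟ i
  ...   | yes refl = ⊥-elim (listed⇒≢ listed-ij refl)
  ...   | no _     = trans (*-comm (𝟙 (listed i j′)) _) (sym (+-identityʳ _))
  𝟙-listed-through {i} {j} listed-ij i′ j′ | no _ with i ≟ j′
  ...   | no _     = *-zeroʳ (𝟙 (listed i′ j′))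
  ...   | yes refl with j ≟ i′
  ...     | yes refl rewrite listed-asym listed-ij = refl
  ...     | no _ with j ≟ i
  ...       | yes refl = ⊥-elim (listed⇒≢ listed-ij refl)
  ...       | no _     = *-zeroʳ (𝟙 (listed i′ i))

  ∑-endpoints : ∀ e (g : Fin (n G) → ℕ) →
    ∑[ u < n G ] (𝟙 (incident G u e) * g u) ≡ g (proj₁ (edgeAt G e)) + g (proj₂ (edgeAt G e))
  ∑-endpoints e g = begin
    ∑[ u < n G ] (𝟙 (eqB u i ∨ eqB u j) * g u)
      ≡⟨ sum-cong-≗ (λ u → trans (cong (_* g u) (𝟙-eqB-∨ (edgeAt-≢ e) u)) (*-distribʳ-+ (g u) (𝟙 (eqB u i)) _)) ⟩
    ∑[ u < n G ] (𝟙 (eqB u i) * g u + 𝟙 (eqB u j) * g u)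
      ≡⟨ ∑-distrib-+ (λ u → 𝟙 (eqB u i) * g u) (λ u → 𝟙 (eqB u j) * g u) ⟩
    ∑[ u < n G ] (𝟙 (eqB u i) * g u) + ∑[ u < n G ] (𝟙 (eqB u j) * g u)
      ≡⟨ cong₂ _+_ (∑-δ′ (n G) i g) (∑-δ′ (n G) j g) ⟩
    g i + g j ∎
    where
    open ≡-Reasoning
    i = proj₁ (edgeAt G e)
    j = proj₂ (edgeAt G e)

  ∑-incident-both : ∀ e →
    ∑[ f < size G ] 𝟙 (incident G (proj₁ (edgeAt G e)) f ∧ incident G (proj₂ (edgeAt G e)) f) ≡ 1
  ∑-incident-both e = begin
    ∑[ f < size G ] 𝟙 (incident G i f ∧ incident G j f)
      ≡⟨ ∑-edgeAt (λ (i′ , j′) → 𝟙 ((eqB i i′ ∨ eqB i j′) ∧ (eqB j i′ ∨ eqB j j′))) ⟩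
    ∑[ i′ < n G ] ∑[ j′ < n G ] (𝟙 (listed i′ j′) * 𝟙 ((eqB i i′ ∨ eqB i j′) ∧ (eqB j i′ ∨ eqB j j′)))
      ≡⟨ sum-cong-≗ (λ i′ → trans (sum-cong-≗ (𝟙-listed-through listed-ij i′))
                                  (sym (*-distribˡ-sum (𝟙 (eqB i i′)) (λ j′ → 𝟙 (eqB j j′) * 𝟙 (listed i′ j′))))) ⟩
    ∑[ i′ < n G ] (𝟙 (eqB i i′) * ∑[ j′ < n G ] (𝟙 (eqB j j′) * 𝟙 (listed i′ j′)))
      ≡⟨ ∑-δ (n G) i _ ⟩
    ∑[ j′ < n G ] (𝟙 (eqB j j′) * 𝟙 (listed i j′))
      ≡⟨ ∑-δ (n G) j _ ⟩
    𝟙 (listed i j)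
      ≡⟨ cong 𝟙 listed-ij ⟩
    1 ∎
    where
    open ≡-Reasoning
    i = proj₁ (edgeAt G e)
    j = proj₂ (edgeAt G e)
    listed-ij = edgeAt-listed e

-- Degrees in T(G) and in G +_T H

module _ (G : Graph) where

  totalAdj-↑ˡ-↑ˡ : ∀ u w → totalAdj G (u ↑ˡ size G) (w ↑ˡ size G) ≡ adj G u w
  totalAdj-↑ˡ-↑ˡ u w rewrite splitAt-↑ˡ (n G) u (size G) | splitAt-↑ˡ (n G) w (size G) = refl

  totalAdj-↑ˡ-↑ʳ : ∀ u f → totalAdj G (u ↑ˡ size G) (n G ↑ʳ f) ≡ incident G u f
  totalAdj-↑ˡ-↑ʳ u f rewrite splitAt-↑ˡ (n G) u (size G) | splitAt-↑ʳ (n G) (size G) f = refl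

  totalAdj-↑ʳ-↑ˡ : ∀ e w → totalAdj G (n G ↑ʳ e) (w ↑ˡ size G) ≡ incident G w e
  totalAdj-↑ʳ-↑ˡ e w rewrite splitAt-↑ʳ (n G) (size G) e | splitAt-↑ˡ (n G) w (size G) = refl

  totalAdj-↑ʳ-↑ʳ : ∀ e f → totalAdj G (n G ↑ʳ e) (n G ↑ʳ f) ≡ edgesAdj G e f
  totalAdj-↑ʳ-↑ʳ e f rewrite splitAt-↑ʳ (n G) (size G) e | splitAt-↑ʳ (n G) (size G) f = refl

  isVertexOfG-↑ˡ : ∀ u → isVertexOfG G (u ↑ˡ size G) ≡ true
  isVertexOfG-↑ˡ u rewrite splitAt-↑ˡ (n G) u (size G) = refl

  isVertexOfG-↑ʳ : ∀ e → isVertexOfG G (n G ↑ʳ e) ≡ false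
  isVertexOfG-↑ʳ e rewrite splitAt-↑ʳ (n G) (size G) e = refl

module _ (G : Graph) (simple : IsSimple G) where
  open IsSimple simple

  𝟙-listed-flip : ∀ u w → 𝟙 (listed G u w) + 𝟙 (listed G w u) ≡ 𝟙 (adj G u w)
  𝟙-listed-flip u w rewrite adj-sym w u with adj G u w in adj-uw
  ... | false = refl
  ... | true with <-cmp (toℕ u) (toℕ w)
  ...   | tri< u<w _ w≮u rewrite <⇒<ᵇ≡true u<w | ≮⇒<ᵇ≡false w≮u = refl
  ...   | tri> u≮w _ w<u rewrite <⇒<ᵇ≡true w<u | ≮⇒<ᵇ≡false u≮w = refl
  ...   | tri≈ _ u≡w _ with toℕ-injective u≡w
  ...     | refl rewrite adj-irrefl u with adj-uw
  ...       | ()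

  ∑-incident : ∀ u → ∑[ e < size G ] 𝟙 (incident G u e) ≡ deg G u
  ∑-incident u = begin
    ∑[ e < size G ] 𝟙 (incident G u e)
      ≡⟨ ∑-edgeAt G (λ (i , j) → 𝟙 (eqB u i ∨ eqB u j)) ⟩
    ∑[ i < N ] ∑[ j < N ] (𝟙 (listed G i j) * 𝟙 (eqB u i ∨ eqB u j))
      ≡⟨ sum-cong-≗ (λ i → trans (sum-cong-≗ (𝟙-listed-incident G u i)) (∑-distrib-+ (u-first i) (u-second i))) ⟩
    ∑[ i < N ] (∑[ j < N ] u-first i j + ∑[ j < N ] u-second i j)
      ≡⟨ ∑-distrib-+ (λ i → ∑[ j < N ] u-first i j) (λ i → ∑[ j < N ] u-second i j) ⟩
    ∑[ i < N ] ∑[ j < N ] u-first i j + ∑[ i < N ] ∑[ j < N ] u-second i j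
      ≡⟨ cong₂ _+_ (trans (sum-cong-≗ (λ i → sym (*-distribˡ-sum (𝟙 (eqB u i)) (𝟙 ∘ listed G i)))) (∑-δ N u _))
                   (sum-cong-≗ (λ i → ∑-δ N u (𝟙 ∘ listed G i))) ⟩
    ∑[ w < N ] 𝟙 (listed G u w) + ∑[ w < N ] 𝟙 (listed G w u)
      ≡⟨ sym (∑-distrib-+ (λ w → 𝟙 (listed G u w)) (λ w → 𝟙 (listed G w u))) ⟩
    ∑[ w < N ] (𝟙 (listed G u w) + 𝟙 (listed G w u))
      ≡⟨ sum-cong-≗ (𝟙-listed-flip u) ⟩
    ∑[ w < N ] 𝟙 (adj G u w)
      ≡⟨ sym (sum-map-allFin N _) ⟩
    deg G u ∎
    where
    open ≡-Reasoning
    N = n G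
    u-first u-second : Fin N → Fin N → ℕ
    u-first i j = 𝟙 (eqB u i) * 𝟙 (listed G i j)
    u-second i j = 𝟙 (eqB u j) * 𝟙 (listed G i j)

  handshake : ∀ (g : Fin (n G) → ℕ) →
    ∑[ e < size G ] (g (proj₁ (edgeAt G e)) + g (proj₂ (edgeAt G e))) ≡ ∑[ u < n G ] (deg G u * g u)
  handshake g = begin
    ∑[ e < size G ] (g (proj₁ (edgeAt G e)) + g (proj₂ (edgeAt G e)))
      ≡⟨ sum-cong-≗ (λ e → sym (∑-endpoints G e g)) ⟩
    ∑[ e < size G ] ∑[ u < n G ] (𝟙 (incident G u e) * g u)
      ≡⟨ ∑-comm (λ e u → 𝟙 (incident G u e) * g u) ⟩
    ∑[ u < n G ] ∑[ e < size G ] (𝟙 (incident G u e) * g u)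
      ≡⟨ sum-cong-≗ (λ u → trans (sym (*-distribʳ-sum (g u) (λ e → 𝟙 (incident G u e)))) (cong (_* g u) (∑-incident u))) ⟩
    ∑[ u < n G ] (deg G u * g u) ∎
    where open ≡-Reasoning

  ∑-deg : ∑[ u < n G ] deg G u ≡ 2 * size G
  ∑-deg = begin
    ∑[ u < n G ] deg G u          ≡⟨ sum-cong-≗ (λ u → sym (*-identityʳ (deg G u))) ⟩
    ∑[ u < n G ] (deg G u * 1)    ≡⟨ sym (handshake (λ _ → 1)) ⟩
    ∑[ e < size G ] 2             ≡⟨ ∑-const (size G) 2 ⟩
    size G * 2                    ≡⟨ *-comm (size G) 2 ⟩
    2 * size G                    ∎
    where open ≡-Reasoning

  -- Inclusion–exclusion over the edges meeting an endpoint of e; e is the only edge meeting both.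
  deg-lineGraph : ∀ e →
    ∑[ f < size G ] 𝟙 (edgesAdj G e f) + 2 ≡ deg G (proj₁ (edgeAt G e)) + deg G (proj₂ (edgeAt G e))
  deg-lineGraph e = begin
    ∑[ f < m ] 𝟙 (not (eqB e f) ∧ either f) + 2
      ≡⟨ cong (λ k → ∑[ f < m ] 𝟙 (not (eqB e f) ∧ either f) + k) (sym (cong₂ _+_ ∑-self (∑-incident-both G e))) ⟩
    ∑[ f < m ] 𝟙 (not (eqB e f) ∧ either f) + (∑[ f < m ] 𝟙 (eqB e f ∧ either f) + ∑[ f < m ] 𝟙 (both f))
      ≡⟨ sym (+-assoc (∑[ f < m ] 𝟙 (not (eqB e f) ∧ either f)) _ _) ⟩
    ∑[ f < m ] 𝟙 (not (eqB e f) ∧ either f) + ∑[ f < m ] 𝟙 (eqB e f ∧ either f) + ∑[ f < m ] 𝟙 (both f)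
      ≡⟨ cong (_+ ∑[ f < m ] 𝟙 (both f)) (trans (sym (∑-distrib-+ (λ f → 𝟙 (not (eqB e f) ∧ either f)) (λ f → 𝟙 (eqB e f ∧ either f))))
                                                (sum-cong-≗ (λ f → 𝟙-not-∧ (eqB e f) (either f)))) ⟩
    ∑[ f < m ] 𝟙 (either f) + ∑[ f < m ] 𝟙 (both f)
      ≡⟨ sym (∑-distrib-+ (𝟙 ∘ either) (𝟙 ∘ both)) ⟩
    ∑[ f < m ] (𝟙 (either f) + 𝟙 (both f))
      ≡⟨ sum-cong-≗ (λ f → 𝟙-∨ (incident G i f) (incident G j f)) ⟩
    ∑[ f < m ] (𝟙 (incident G i f) + 𝟙 (incident G j f))
      ≡⟨ ∑-distrib-+ (λ f → 𝟙 (incident G i f)) (λ f → 𝟙 (incident G j f)) ⟩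
    ∑[ f < m ] 𝟙 (incident G i f) + ∑[ f < m ] 𝟙 (incident G j f)
      ≡⟨ cong₂ _+_ (∑-incident i) (∑-incident j) ⟩
    deg G i + deg G j ∎
    where
    open ≡-Reasoning
    m = size G
    i = proj₁ (edgeAt G e)
    j = proj₂ (edgeAt G e)
    either both : Fin m → Bool
    either f = incident G i f ∨ incident G j f
    both f = incident G i f ∧ incident G j f
    ∑-self : ∑[ f < m ] 𝟙 (eqB e f ∧ either f) ≡ 1
    ∑-self = begin
      ∑[ f < m ] 𝟙 (eqB e f ∧ either f)       ≡⟨ sum-cong-≗ (λ f → 𝟙-∧ (eqB e f) (either f)) ⟩
      ∑[ f < m ] (𝟙 (eqB e f) * 𝟙 (either f)) ≡⟨ ∑-δ m e (𝟙 ∘ either) ⟩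
      𝟙 (either e)                             ≡⟨ cong (λ b → 𝟙 ((b ∨ eqB i j) ∨ (eqB j i ∨ eqB j j))) (eqB-refl i) ⟩
      1                                        ∎

  totalAdj-irrefl : ∀ a → totalAdj G a a ≡ false
  totalAdj-irrefl a with splitAt (n G) a
  ... | inj₁ u = adj-irrefl u
  ... | inj₂ e rewrite eqB-refl e = refl

  deg-TotalGraph-vertex : ∀ u → deg (TotalGraph G) (u ↑ˡ size G) ≡ 2 * deg G u
  deg-TotalGraph-vertex u = begin
    deg (TotalGraph G) (u ↑ˡ m)
      ≡⟨ sum-map-allFin (N + m) _ ⟩
    ∑[ a < N + m ] 𝟙 (totalAdj G (u ↑ˡ m) a)
      ≡⟨ ∑-splitAt N m _ ⟩
    ∑[ w < N ] 𝟙 (totalAdj G (u ↑ˡ m) (w ↑ˡ m)) + ∑[ f < m ] 𝟙 (totalAdj G (u ↑ˡ m) (N ↑ʳ f))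
      ≡⟨ cong₂ _+_ (sum-cong-≗ (cong 𝟙 ∘ totalAdj-↑ˡ-↑ˡ G u)) (sum-cong-≗ (cong 𝟙 ∘ totalAdj-↑ˡ-↑ʳ G u)) ⟩
    ∑[ w < N ] 𝟙 (adj G u w) + ∑[ f < m ] 𝟙 (incident G u f)
      ≡⟨ cong₂ _+_ (sym (sum-map-allFin N _)) (∑-incident u) ⟩
    deg G u + deg G u
      ≡⟨ cong (deg G u +_) (sym (+-identityʳ (deg G u))) ⟩
    2 * deg G u ∎
    where
    open ≡-Reasoning
    N = n G
    m = size G

  deg-TotalGraph-edge : ∀ e →
    deg (TotalGraph G) (n G ↑ʳ e) ≡ deg G (proj₁ (edgeAt G e)) + deg G (proj₂ (edgeAt G e))
  deg-TotalGraph-edge e = begin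
    deg (TotalGraph G) (N ↑ʳ e)
      ≡⟨ sum-map-allFin (N + m) _ ⟩
    ∑[ a < N + m ] 𝟙 (totalAdj G (N ↑ʳ e) a)
      ≡⟨ ∑-splitAt N m _ ⟩
    ∑[ w < N ] 𝟙 (totalAdj G (N ↑ʳ e) (w ↑ˡ m)) + ∑[ f < m ] 𝟙 (totalAdj G (N ↑ʳ e) (N ↑ʳ f))
      ≡⟨ cong₂ _+_ (sum-cong-≗ (λ w → trans (cong 𝟙 (totalAdj-↑ʳ-↑ˡ G e w)) (sym (*-identityʳ _))))
                   (sum-cong-≗ (cong 𝟙 ∘ totalAdj-↑ʳ-↑ʳ G e)) ⟩
    ∑[ w < N ] (𝟙 (incident G w e) * 1) + ∑[ f < m ] 𝟙 (edgesAdj G e f)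
      ≡⟨ cong (_+ ∑[ f < m ] 𝟙 (edgesAdj G e f)) (∑-endpoints G e (λ _ → 1)) ⟩
    2 + ∑[ f < m ] 𝟙 (edgesAdj G e f)
      ≡⟨ +-comm 2 _ ⟩
    ∑[ f < m ] 𝟙 (edgesAdj G e f) + 2
      ≡⟨ deg-lineGraph e ⟩
    deg G (proj₁ (edgeAt G e)) + deg G (proj₂ (edgeAt G e)) ∎
    where
    open ≡-Reasoning
    N = n G
    m = size G

module _ (G H : Graph) where

  tSumAdj-combine : ∀ a v a′ v′ → tSumAdj G H (combine a v) (combine a′ v′)
    ≡ (eqB a a′ ∧ isVertexOfG G a ∧ adj H v v′) ∨ (eqB v v′ ∧ totalAdj G a a′)
  tSumAdj-combine a v a′ v′ =
    trans (tSumAdj-remQuot (combine a v) (combine a′ v′))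
          (cong₂ adjacentPairs (remQuot-combine {k = n H} a v) (remQuot-combine {k = n H} a′ v′))
    where
    Pair = Fin (n G + size G) × Fin (n H)
    adjacentPairs : Pair → Pair → Bool
    adjacentPairs (a , v) (a′ , v′) = (eqB a a′ ∧ isVertexOfG G a ∧ adj H v v′) ∨ (eqB v v′ ∧ totalAdj G a a′)
    tSumAdj-remQuot : ∀ p q → tSumAdj G H p q ≡ adjacentPairs (remQuot (n H) p) (remQuot (n H) q)
    tSumAdj-remQuot p q with remQuot {n G + size G} (n H) p | remQuot {n G + size G} (n H) q
    ... | _ , _ | _ , _ = refl

module _ (G H : Graph) (simple : IsSimple G) where

  deg-+T : ∀ a v → deg (G +T H) (combine a v) ≡ 𝟙 (isVertexOfG G a) * deg H v + deg (TotalGraph G) a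
  deg-+T a v = begin
    deg (G +T H) (combine a v)
      ≡⟨ sum-map-allFin ((N + m) * h) _ ⟩
    ∑[ q < (N + m) * h ] 𝟙 (tSumAdj G H (combine a v) q)
      ≡⟨ ∑-combine (N + m) h _ ⟩
    ∑[ a′ < N + m ] ∑[ v′ < h ] 𝟙 (tSumAdj G H (combine a v) (combine a′ v′))
      ≡⟨ sum-cong-≗ (λ a′ → sum-cong-≗ (λ v′ → trans (cong 𝟙 (tSumAdj-combine G H a v a′ v′))
                                                      (𝟙-∨-∧ (eqB a a′) _ (eqB v v′) _ (no-loop a′)))) ⟩
    ∑[ a′ < N + m ] ∑[ v′ < h ] (𝟙 (eqB a a′) * inH v′ + 𝟙 (eqB v v′) * inT a′)
      ≡⟨ sum-cong-≗ (λ a′ → ∑-distrib-+ (λ v′ → 𝟙 (eqB a a′) * inH v′) (λ v′ → 𝟙 (eqB v v′) * inT a′)) ⟩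
    ∑[ a′ < N + m ] (∑[ v′ < h ] (𝟙 (eqB a a′) * inH v′) + ∑[ v′ < h ] (𝟙 (eqB v v′) * inT a′))
      ≡⟨ ∑-distrib-+ (λ a′ → ∑[ v′ < h ] (𝟙 (eqB a a′) * inH v′)) (λ a′ → ∑[ v′ < h ] (𝟙 (eqB v v′) * inT a′)) ⟩
    ∑[ a′ < N + m ] ∑[ v′ < h ] (𝟙 (eqB a a′) * inH v′) + ∑[ a′ < N + m ] ∑[ v′ < h ] (𝟙 (eqB v v′) * inT a′)
      ≡⟨ cong₂ _+_ (trans (∑-comm (λ a′ v′ → 𝟙 (eqB a a′) * inH v′)) (sum-cong-≗ (λ v′ → ∑-δ (N + m) a (λ _ → inH v′))))
                   (sum-cong-≗ (λ a′ → ∑-δ h v (λ _ → inT a′))) ⟩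
    ∑[ v′ < h ] inH v′ + ∑[ a′ < N + m ] inT a′
      ≡⟨ cong₂ _+_ ∑-inH (sym (sum-map-allFin (N + m) inT)) ⟩
    𝟙 (isVertexOfG G a) * deg H v + deg (TotalGraph G) a ∎
    where
    open ≡-Reasoning
    N = n G
    m = size G
    h = n H
    inH : Fin h → ℕ
    inH v′ = 𝟙 (isVertexOfG G a ∧ adj H v v′)
    inT : Fin (N + m) → ℕ
    inT a′ = 𝟙 (totalAdj G a a′)
    no-loop : ∀ a′ → eqB a a′ ≡ true → totalAdj G a a′ ≡ false
    no-loop a′ a≡a′ rewrite eqB≡true⇒≡ a≡a′ = totalAdj-irrefl G simple a′
    ∑-inH : ∑[ v′ < h ] inH v′ ≡ 𝟙 (isVertexOfG G a) * deg H v
    ∑-inH = begin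
      ∑[ v′ < h ] inH v′
        ≡⟨ sum-cong-≗ (λ v′ → 𝟙-∧ (isVertexOfG G a) (adj H v v′)) ⟩
      ∑[ v′ < h ] (𝟙 (isVertexOfG G a) * 𝟙 (adj H v v′))
        ≡⟨ sym (*-distribˡ-sum (𝟙 (isVertexOfG G a)) (𝟙 ∘ adj H v)) ⟩
      𝟙 (isVertexOfG G a) * ∑[ v′ < h ] 𝟙 (adj H v v′)
        ≡⟨ cong (𝟙 (isVertexOfG G a) *_) (sym (sum-map-allFin h _)) ⟩
      𝟙 (isVertexOfG G a) * deg H v ∎

  deg-+T-vertex : ∀ u v → deg (G +T H) (combine (u ↑ˡ size G) v) ≡ deg H v + 2 * deg G u
  deg-+T-vertex u v = begin
    deg (G +T H) (combine (u ↑ˡ size G) v)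
      ≡⟨ deg-+T (u ↑ˡ size G) v ⟩
    𝟙 (isVertexOfG G (u ↑ˡ size G)) * deg H v + deg (TotalGraph G) (u ↑ˡ size G)
      ≡⟨ cong₂ _+_ (cong (λ b → 𝟙 b * deg H v) (isVertexOfG-↑ˡ G u)) (deg-TotalGraph-vertex G simple u) ⟩
    1 * deg H v + 2 * deg G u
      ≡⟨ cong (_+ 2 * deg G u) (+-identityʳ (deg H v)) ⟩
    deg H v + 2 * deg G u ∎
    where open ≡-Reasoning

  deg-+T-edge : ∀ e v →
    deg (G +T H) (combine (n G ↑ʳ e) v) ≡ deg G (proj₁ (edgeAt G e)) + deg G (proj₂ (edgeAt G e))
  deg-+T-edge e v = begin
    deg (G +T H) (combine (n G ↑ʳ e) v)
      ≡⟨ deg-+T (n G ↑ʳ e) v ⟩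
    𝟙 (isVertexOfG G (n G ↑ʳ e)) * deg H v + deg (TotalGraph G) (n G ↑ʳ e)
      ≡⟨ cong₂ _+_ (cong (λ b → 𝟙 b * deg H v) (isVertexOfG-↑ʳ G e)) (deg-TotalGraph-edge G simple e) ⟩
    deg G (proj₁ (edgeAt G e)) + deg G (proj₂ (edgeAt G e)) ∎
    where open ≡-Reasoning

  F-+T : F (G +T H) ≡ ∑[ u < n G ] ∑[ v < n H ] ((deg H v + 2 * deg G u) ^ 3)
                      + ∑[ e < size G ] ∑[ v < n H ] ((deg G (proj₁ (edgeAt G e)) + deg G (proj₂ (edgeAt G e))) ^ 3)
  F-+T = begin
    F (G +T H)
      ≡⟨ degPowSum-∑ 3 (G +T H) ⟩
    ∑[ q < (n G + size G) * n H ] (deg (G +T H) q ^ 3)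
      ≡⟨ ∑-combine (n G + size G) (n H) _ ⟩
    ∑[ a < n G + size G ] ∑[ v < n H ] (deg (G +T H) (combine a v) ^ 3)
      ≡⟨ ∑-splitAt (n G) (size G) _ ⟩
    ∑[ u < n G ] ∑[ v < n H ] (deg (G +T H) (combine (u ↑ˡ size G) v) ^ 3)
      + ∑[ e < size G ] ∑[ v < n H ] (deg (G +T H) (combine (n G ↑ʳ e) v) ^ 3)
      ≡⟨ cong₂ _+_ (sum-cong-≗ λ u → sum-cong-≗ λ v → cong (_^ 3) (deg-+T-vertex u v))
                   (sum-cong-≗ λ e → sum-cong-≗ λ v → cong (_^ 3) (deg-+T-edge e v)) ⟩
    ∑[ u < n G ] ∑[ v < n H ] ((deg H v + 2 * deg G u) ^ 3)
      + ∑[ e < size G ] ∑[ v < n H ] ((deg G (proj₁ (edgeAt G e)) + deg G (proj₂ (edgeAt G e))) ^ 3) ∎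
    where open ≡-Reasoning

  ∑-cube-edgeCopies :
    ∑[ e < size G ] ∑[ v < n H ] ((deg G (proj₁ (edgeAt G e)) + deg G (proj₂ (edgeAt G e))) ^ 3)
      ≡ n H * (ξ₄ G + 3 * ReZM G)
  ∑-cube-edgeCopies = begin
    ∑[ e < size G ] ∑[ v < h ] ((d₁ e + d₂ e) ^ 3)
      ≡⟨ sum-cong-≗ (λ e → ∑-const h ((d₁ e + d₂ e) ^ 3)) ⟩
    ∑[ e < size G ] (h * (d₁ e + d₂ e) ^ 3)
      ≡⟨ sym (*-distribˡ-sum h (λ e → (d₁ e + d₂ e) ^ 3)) ⟩
    h * ∑[ e < size G ] ((d₁ e + d₂ e) ^ 3)
      ≡⟨ cong (h *_) (sum-cong-≗ (λ e → cube-of-sum (d₁ e) (d₂ e))) ⟩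
    h * ∑[ e < size G ] ((d₁ e ^ 3 + d₂ e ^ 3) + 3 * (d₁ e * d₂ e * (d₁ e + d₂ e)))
      ≡⟨ cong (h *_) (∑-distrib-+ (λ e → d₁ e ^ 3 + d₂ e ^ 3) (λ e → 3 * (d₁ e * d₂ e * (d₁ e + d₂ e)))) ⟩
    h * (∑[ e < size G ] (d₁ e ^ 3 + d₂ e ^ 3) + ∑[ e < size G ] (3 * (d₁ e * d₂ e * (d₁ e + d₂ e))))
      ≡⟨ cong (h *_) (cong₂ _+_ (trans (handshake G simple (λ u → deg G u ^ 3)) (sym (degPowSum-∑ 4 G)))
                                (trans (sym (*-distribˡ-sum 3 (λ e → d₁ e * d₂ e * (d₁ e + d₂ e))))
                                       (cong (3 *_) (sym (sum-map-lookup (edgeList G) _))))) ⟩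
    h * (ξ₄ G + 3 * ReZM G) ∎
    where
    open ≡-Reasoning
    h = n H
    d₁ d₂ : Fin (size G) → ℕ
    d₁ e = deg G (proj₁ (edgeAt G e))
    d₂ e = deg G (proj₂ (edgeAt G e))
    cube-of-sum : ∀ a b → (a + b) ^ 3 ≡ (a ^ 3 + b ^ 3) + 3 * (a * b * (a + b))
    cube-of-sum = solve 2 (λ a b → (a :+ b) :^ 3 := (a :^ 3 :+ b :^ 3) :+ con 3 :* (a :* b :* (a :+ b))) refl

∑-cube-vertexCopies : ∀ G H → IsSimple G → IsSimple H →
  ∑[ u < n G ] ∑[ v < n H ] ((deg H v + 2 * deg G u) ^ 3)
    ≡ 8 * n H * F G + 24 * size H * M₁ G + 12 * size G * M₁ H + n G * F H
∑-cube-vertexCopies G H simpleG simpleH = begin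
  ∑[ u < n G ] ∑[ v < h ] ((deg H v + 2 * deg G u) ^ 3)
    ≡⟨ sum-cong-≗ (λ u → ∑-cube-row (deg G u)) ⟩
  ∑[ u < n G ] (8 * h * deg G u ^ 3 + 24 * size H * deg G u ^ 2 + 6 * M₁ H * deg G u + F H)
    ≡⟨ ∑-cubic (n G) (8 * h) (24 * size H) (6 * M₁ H) (F H) (deg G) ⟩
  8 * h * ∑[ u < n G ] (deg G u ^ 3) + 24 * size H * ∑[ u < n G ] (deg G u ^ 2)
    + 6 * M₁ H * ∑[ u < n G ] deg G u + n G * F H
    ≡⟨ cong₂ (λ s t → s + t + n G * F H)
             (sym (cong₂ (λ p q → 8 * h * p + 24 * size H * q) (degPowSum-∑ 3 G) (degPowSum-∑ 2 G)))
             (cong (6 * M₁ H *_) (∑-deg G simpleG)) ⟩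
  8 * h * F G + 24 * size H * M₁ G + 6 * M₁ H * (2 * size G) + n G * F H
    ≡⟨ cong (λ t → 8 * h * F G + 24 * size H * M₁ G + t + n G * F H) (regroup-linear (M₁ H) (size G)) ⟩
  8 * h * F G + 24 * size H * M₁ G + 12 * size G * M₁ H + n G * F H ∎
  where
  open ≡-Reasoning
  h = n H
  expand : ∀ x y → (x + 2 * y) ^ 3 ≡ 1 * x ^ 3 + 6 * y * x ^ 2 + 12 * y ^ 2 * x + 8 * y ^ 3
  expand = solve 2 (λ x y → (x :+ con 2 :* y) :^ 3
                            := con 1 :* x :^ 3 :+ con 6 :* y :* x :^ 2 :+ con 12 :* y :^ 2 :* x :+ con 8 :* y :^ 3) refl
  regroup : ∀ f₃ f₂ m k y →
    1 * f₃ + 6 * y * f₂ + 12 * y ^ 2 * (2 * m) + k * (8 * y ^ 3) ≡ 8 * k * y ^ 3 + 24 * m * y ^ 2 + 6 * f₂ * y + f₃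
  regroup = solve 5 (λ f₃ f₂ m k y → con 1 :* f₃ :+ con 6 :* y :* f₂ :+ con 12 :* y :^ 2 :* (con 2 :* m) :+ k :* (con 8 :* y :^ 3)
                                     := con 8 :* k :* y :^ 3 :+ con 24 :* m :* y :^ 2 :+ con 6 :* f₂ :* y :+ f₃) refl
  regroup-linear : ∀ f₂ m → 6 * f₂ * (2 * m) ≡ 12 * m * f₂
  regroup-linear = solve-∀
  ∑-cube-row : ∀ y → ∑[ v < h ] ((deg H v + 2 * y) ^ 3) ≡ 8 * h * y ^ 3 + 24 * size H * y ^ 2 + 6 * M₁ H * y + F H
  ∑-cube-row y = begin
    ∑[ v < h ] ((deg H v + 2 * y) ^ 3)
      ≡⟨ sum-cong-≗ (λ v → expand (deg H v) y) ⟩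
    ∑[ v < h ] (1 * deg H v ^ 3 + 6 * y * deg H v ^ 2 + 12 * y ^ 2 * deg H v + 8 * y ^ 3)
      ≡⟨ ∑-cubic h 1 (6 * y) (12 * y ^ 2) (8 * y ^ 3) (deg H) ⟩
    1 * ∑[ v < h ] (deg H v ^ 3) + 6 * y * ∑[ v < h ] (deg H v ^ 2) + 12 * y ^ 2 * ∑[ v < h ] deg H v + h * (8 * y ^ 3)
      ≡⟨ cong₂ (λ s t → s + t + h * (8 * y ^ 3))
               (sym (cong₂ (λ p q → 1 * p + 6 * y * q) (degPowSum-∑ 3 H) (degPowSum-∑ 2 H)))
               (cong (12 * y ^ 2 *_) (∑-deg H simpleH)) ⟩
    1 * F H + 6 * y * M₁ H + 12 * y ^ 2 * (2 * size H) + h * (8 * y ^ 3)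
      ≡⟨ regroup (F H) (M₁ H) (size H) h y ⟩
    8 * h * y ^ 3 + 24 * size H * y ^ 2 + 6 * M₁ H * y + F H ∎

theorem5 : (G H : Graph) → IsSimple G → IsSimple H → Connected G → Connected H → 2 ≤ order G →
    F (G +T H) ≡ 8 * order H * F G + order G * F H + 24 * size H * M₁ G + 12 * size G * M₁ H
                 + order H * ξ₄ G + 3 * order H * ReZM G
theorem5 G H simpleG simpleH _ _ _ = begin
  F (G +T H)
    ≡⟨ F-+T G H simpleG ⟩
  ∑[ u < n G ] ∑[ v < n H ] ((deg H v + 2 * deg G u) ^ 3)
    + ∑[ e < size G ] ∑[ v < n H ] ((deg G (proj₁ (edgeAt G e)) + deg G (proj₂ (edgeAt G e))) ^ 3)
    ≡⟨ cong₂ _+_ (∑-cube-vertexCopies G H simpleG simpleH) (∑-cube-edgeCopies G H simpleG) ⟩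
  8 * n H * F G + 24 * size H * M₁ G + 12 * size G * M₁ H + n G * F H + n H * (ξ₄ G + 3 * ReZM G)
    ≡⟨ regroup (n G) (n H) (size G) (size H) (F G) (F H) (M₁ G) (M₁ H) (ξ₄ G) (ReZM G) ⟩
  8 * n H * F G + n G * F H + 24 * size H * M₁ G + 12 * size G * M₁ H + n H * ξ₄ G + 3 * n H * ReZM G ∎
  where
  open ≡-Reasoning
  regroup : ∀ nG nH mG mH FG FH M₁G M₁H ξ₄G ReZMG →
    8 * nH * FG + 24 * mH * M₁G + 12 * mG * M₁H + nG * FH + nH * (ξ₄G + 3 * ReZMG)
      ≡ 8 * nH * FG + nG * FH + 24 * mH * M₁G + 12 * mG * M₁H + nH * ξ₄G + 3 * nH * ReZMG
  regroup = solve-∀
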